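{- Let $n$, $d$ and $k$ be positive integers such that $d\ge 2$ (and $d\le n/2$, so that the circulant graph $C_n(1,d)$ is defined). If $C$ is an identifying code in $C_n(1,d)$ with $k$ codewords, then there exists an identifying code in the infinite square grid $\mathcal{S}$ with density $k/n$. Analogously, if $C$ is a locating-dominating code in $C_n(1,d)$ with $k$ codewords, then there exists a locating-dominating code in $\mathcal{S}$ with density $k/n$; and if $C$ is a self-identifying code in $C_n(1,d)$ with $k$ codewords, then there exists a self-identifying code in $\mathcal{S}$ with density $k/n$.
   Context: All graphs are simple and undirected. For a graph $G=(V,E)$ and $u\in V$, $N[u]=\{u\}\cup\{v: uv\in E\}$ is the closed neighbourhood. A code is a nonempty subset $C\subseteq V$; its elements are codewords. The identifying set of $u$ is $I(C;u)=N[u]\cap C$. $C$ is dominating if $I(C;u)\neq\emptyset$ for all $u\in V$. $C$ is identifying if it is dominating and $I(C;u)\neq I(C;v)$ for all distinct $u,v\in V$. $C$ is locating-dominating if it is dominating and $I(C;u)\neq I(C;v)$ for all distinct $u,v\in V\setminus C$. $C$ is self-identifying if $I(C;u)\setminus I(C;v)\neq\emptyset$ for all distinct $u,v\in V$. For positive integers $n$ and $d_1,\dots,d_k\le n/2$, the circulant graph $C_n(d_1,\dots,d_k)$ has vertex set $\mathbb{Z}_n=\{0,\dots,n-1\}$, and the open neighbourhood of $u$ is $\{u\pm d_1,\dots,u\pm d_k\}$ (computed modulo $n$). The infinite square grid $\mathcal{S}$ has vertex set $\mathbb{Z}^2$, with $N[(x,y)]=\{(x',y')\in\mathbb{Z}^2: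 |x-x'|+|y-y'|\le 1\}$. With $Q_m=\{(x,y)\in\mathbb{Z}^2: |x|\le m, |y|\le m\}$, the density of a code $C\subseteq\mathbb{Z}^2$ is $D(C)=\limsup_{m\to\infty}|C\cap Q_m|/|Q_m|$. -}

module Defs where

open import Level using (Level; 0ℓ)
open import Data.Nat as ℕ using (ℕ; zero; suc; _%_; NonZero)
open import Data.Fin using (Fin; toℕ)
open import Data.Fin.Subset using (Subset; _∈_)
open import Data.Integer as ℤ using (ℤ; +_; ∣_∣)
open import Data.Rational as ℚ using (ℚ; Positive)
open import Data.Bool using (Bool; true)
open import Data.List using (List; map; upTo; filter; length; concatMap)
open import Data.Product using (_×_; Σ; ∃; ∃-syntax; _,_)
open import Data.Sum using (_⊎_)
open import Relation.Nullary using (¬_)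
open import Relation.Binary.PropositionalEquality using (_≡_; _≢_)
open import Data.Bool using () renaming (_≟_ to _≟ᵇ_)
open import Function.Bundles using (_⇔_)

-- Generic graph notions.  A graph is given by its vertex type V and its
-- closed-neighbourhood relation  NB u w  meaning  w ∈ N[u].
-- A code is given by a membership predicate  C : V → Set.

module _ {V : Set} (NB : V → V → Set) (C : V → Set) where

  InI : V → V → Set
  InI u w = NB u w × C w

  SameI : V → V → Set
  SameI u v = ∀ w → (InI u w ⇔ InI v w)

  Nonempty : Set
  Nonempty = ∃[ w ] C w

  Dominating : Set
  Dominating = ∀ u → ∃[ w ] InI u w

  Identifying : Set
  Identifying = Nonempty × Dominating × (∀ u v → u ≢ v → ¬ SameI u v)

  LocatingDominating : Set
  LocatingDominating =
    Nonempty × Dominating × (∀ u v → u ≢ v → ¬ C u → ¬ C v → ¬ SameI u v)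

  SelfIdentifying : Set
  SelfIdentifying =
    Nonempty × (∀ u v → u ≢ v → ∃[ w ] (InI u w × ¬ InI v w))

-- Circulant graph C_n(1,d) on Z_n = Fin n.
-- w ∈ N[u] iff w ≡ u ± j (mod n) for some j ∈ {0, 1, d}.

DiffBy : (n : ℕ) .{{_ : NonZero n}} → ℕ → Fin n → Fin n → Set
DiffBy n j u w = ((toℕ u ℕ.+ j) % n ≡ toℕ w) ⊎ ((toℕ w ℕ.+ j) % n ≡ toℕ u)

CircN : (n d : ℕ) .{{_ : NonZero n}} → Fin n → Fin n → Set
CircN n d u w = DiffBy n 0 u w ⊎ DiffBy n 1 u w ⊎ DiffBy n d u w

ℤ² : Set
ℤ² = ℤ × ℤ

GridN : ℤ² → ℤ² → Set
GridN (x , y) (x' , y') = ∣ x ℤ.- x' ∣ ℕ.+ ∣ y ℤ.- y' ∣ ℕ.≤ 1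

GridCode : Set
GridCode = ℤ² → Bool

InCode : GridCode → ℤ² → Set
InCode f p = f p ≡ true

range : ℕ → List ℤ
range m = map (λ i → + i ℤ.- + m) (upTo (suc (2 ℕ.* m)))

Qm : ℕ → List ℤ²
Qm m = concatMap (λ x → map (λ y → (x , y)) (range m)) (range m)

countQ : GridCode → ℕ → ℕ
countQ f m = length (filter (λ p → f p ≟ᵇ true) (Qm m))

ratio : GridCode → ℕ → ℚ
ratio f m = (+ countQ f m) ℚ./ (suc (2 ℕ.* m) ℕ.* suc (2 ℕ.* m))

-- D(C) = q, i.e. limsup_{m→∞} ratio f m = q (unfolded ε-definition)
DensityEq : GridCode → ℚ → Set
DensityEq f q =
  ∀ (ε : ℚ) → Positive ε →
    (∃[ M ] ∀ m → M ℕ.≤ m → ratio f m ℚ.< q ℚ.+ ε)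
    × (∀ M → ∃[ m ] (M ℕ.≤ m × q ℚ.- ε ℚ.< ratio f m))

module Submission where

-- The map π (x , y) = d x + y (mod n) sends the steps 0, ±(1,0), ±(0,1) of the grid to the steps
-- 0, ±d, ±1 of C_n(1,d).  Because d + 1 < n, two distinct steps never differ by a multiple of n,
-- except east and west when n = 2d; so π maps every closed neighbourhood of the grid onto the
-- closed neighbourhood of the image, and the pulled-back code π⁻¹(C) separates vertices in
-- different fibres exactly as C separates their images.  Two distinct vertices p, q of one fibre
-- with a common neighbour r = p + s₁ = q + s₂ force {s₁, s₂} = {east, west}; then p + s₂ lies in
-- the fibre of r at distance 3 from q, so p and q are separated as well.  Every column of π⁻¹(C)
-- is C repeated with period n, so a window of L consecutive points of a column holds
-- L k / n ± k codewords, and the density is k / n.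

import Algebra.Properties.AbelianGroup
open import Data.Bool using (Bool; true; false)
open import Data.Fin as Fin using (Fin; toℕ; fromℕ<; punchIn)
open import Data.Fin.Properties using (toℕ-fromℕ<; toℕ-injective; toℕ<n; punchInᵢ≢i)
open import Data.Fin.Subset using (Subset; _∈_; ∣_∣)
open import Data.Integer as ℤ using (ℤ; +_; -[1+_]; _⊖_; _%ℕ_; _/ℕ_)
open import Data.Integer.DivMod using (n%ℕd<d; a≡a%ℕn+[a/ℕn]*n)
open import Data.Integer.Divisibility.Signed
  using (_∣_; divides; ∣⇒∣ᵤ; ∣m∣n⇒∣m+n; ∣m∣n⇒∣m-n; ∣m⇒∣-m)
import Data.Integer.Properties as ℤₚ
open import Data.List
  using (List; []; _∷_; _++_; map; length; filter; concatMap; applyUpTo; upTo)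
import Data.List.Properties as Listₚ
open import Data.Nat as ℕ using (ℕ; zero; suc; z≤n; s≤s; z<s; NonZero; >-nonZero; _%_)
open import Data.Nat.DivMod using (m<n⇒m%n≡m; m≡m%n+[m/n]*n; m%n<n; [m+n]%n≡m%n)
open import Data.Nat.Divisibility using (>⇒∤)
open import Data.Nat.ListAction using (sum)
import Data.Nat.Properties as ℕₚ
open import Data.Product using (_×_; _,_; ∃-syntax; proj₁; proj₂)
open import Data.Rational using (_/_)
open import Data.Sum using (_⊎_; inj₁; inj₂; [_,_])
open import Data.Vec using (Vec; []; _∷_; lookup)
open import Data.Vec.Properties using ([]=⇒lookup; lookup⇒[]=)
open import Function using (_∘_; id)
open import Function.Bundles using (_⇔_; mk⇔; Equivalence)
import Function.Properties.Equivalence as ⇔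
open import Level using (0ℓ)
open import Relation.Binary.Definitions using (DecidableEquality)
open import Relation.Binary.PropositionalEquality
open import Relation.Nullary using (¬_; Dec; yes; no; contradiction)
open import Relation.Unary using (Pred; Decidable)

open import Defs

∣m⊖n∣<k : ∀ {m n k} → m ℕ.< k → n ℕ.< k → ℤ.∣ m ⊖ n ∣ ℕ.< k
∣m⊖n∣<k {m} {n} m<k n<k with ℕₚ.≤-total m n
... | inj₁ m≤n =
  subst (ℕ._< _) (sym (ℤₚ.∣⊖∣-≤ m≤n)) (ℕₚ.≤-<-trans (ℕₚ.m∸n≤m n m) n<k)
... | inj₂ n≤m =
  subst (ℕ._< _) (sym (trans (ℤₚ.∣m⊖n∣≡∣n⊖m∣ m n) (ℤₚ.∣⊖∣-≤ n≤m)))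
    (ℕₚ.≤-<-trans (ℕₚ.m∸n≤m m n) m<k)

module Residue (n : ℕ) .{{_ : NonZero n}} where

  open import Data.Integer using (_+_; _-_; -_)
  open import Data.Integer.Tactic.RingSolver using (solve-∀)

  residue : ℤ → Fin n
  residue z = fromℕ< (n%ℕd<d z n)

  toℕ-residue : ∀ z → toℕ (residue z) ≡ z %ℕ n
  toℕ-residue z = toℕ-fromℕ< (n%ℕd<d z n)

  ∤-short : ∀ {i} → 0 ℕ.< ℤ.∣ i ∣ → ℤ.∣ i ∣ ℕ.< n → ¬ (+ n ∣ i)
  ∤-short 0<∣i∣ ∣i∣<n n∣i = >⇒∤ {{>-nonZero 0<∣i∣}} ∣i∣<n (∣⇒∣ᵤ n∣i)

  ∣-swap : ∀ a b → + n ∣ a - b → + n ∣ b - a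
  ∣-swap a b n∣a-b = subst (+ n ∣_) (negate a b) (∣m⇒∣-m n∣a-b)
    where
    negate : ∀ a b → - (a - b) ≡ b - a
    negate = solve-∀

  congruent-below-n⇒≡ : ∀ {r s} → r ℕ.< n → s ℕ.< n → + n ∣ + r - + s → r ≡ s
  congruent-below-n⇒≡ {r} {s} r<n s<n n∣r-s with ℤ.∣ + r - + s ∣ ℕ.≟ 0
  ... | yes ∣r-s∣≡0 = ℤₚ.+-injective (ℤₚ.i-j≡0⇒i≡j _ _ (ℤₚ.∣i∣≡0⇒i≡0 ∣r-s∣≡0))
  ... | no ∣r-s∣≢0  = contradiction n∣r-s (∤-short (ℕₚ.n≢0⇒n>0 ∣r-s∣≢0) ∣r-s∣<n)
    where
    ∣r-s∣<n : ℤ.∣ + r - + s ∣ ℕ.< n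
    ∣r-s∣<n = subst (ℕ._< n) (cong ℤ.∣_∣ (sym (ℤₚ.m-n≡m⊖n r s))) (∣m⊖n∣<k r<n s<n)

  n∣z-residue : ∀ z → + n ∣ z - + toℕ (residue z)
  n∣z-residue z = divides (z /ℕ n) (begin
    z - + toℕ (residue z)       ≡⟨ cong (λ r → z - + r) (toℕ-residue z) ⟩
    z - + r                     ≡⟨ cong (_- + r) (a≡a%ℕn+[a/ℕn]*n z n) ⟩
    + r + z /ℕ n ℤ.* + n - + r  ≡⟨ cancel (+ r) (z /ℕ n ℤ.* + n) ⟩
    z /ℕ n ℤ.* + n              ∎)
    where
    open ≡-Reasoning
    r = z %ℕ n
    cancel : ∀ r m → r + m - r ≡ m
    cancel = solve-∀

  ∣⇒residue-≡ : ∀ a b → + n ∣ a - b → residue a ≡ residue b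
  ∣⇒residue-≡ a b n∣a-b =
    toℕ-injective (congruent-below-n⇒≡ (toℕ<n (residue a)) (toℕ<n (residue b)) n∣ra-rb)
    where
    regroup : ∀ a b r s → a - b - (a - r) + (b - s) ≡ r - s
    regroup = solve-∀
    n∣ra-rb : + n ∣ + toℕ (residue a) - + toℕ (residue b)
    n∣ra-rb = subst (+ n ∣_) (regroup a b _ _)
      (∣m∣n⇒∣m+n (∣m∣n⇒∣m-n n∣a-b (n∣z-residue a)) (n∣z-residue b))

  residue-≡⇒∣ : ∀ a b → residue a ≡ residue b → + n ∣ a - b
  residue-≡⇒∣ a b ra≡rb = subst (+ n ∣_) (regroup a b _) (∣m∣n⇒∣m-n (n∣z-residue a) n∣b-ra)
    where
    regroup : ∀ a b r → a - r - (b - r) ≡ a - b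
    regroup = solve-∀
    n∣b-ra : + n ∣ b - + toℕ (residue a)
    n∣b-ra = subst (λ r → + n ∣ b - + toℕ r) (sym ra≡rb) (n∣z-residue b)

  residue-+-cong : ∀ a b c → residue a ≡ residue b → residue (a + c) ≡ residue (b + c)
  residue-+-cong a b c ra≡rb =
    ∣⇒residue-≡ (a + c) (b + c) (subst (+ n ∣_) (sym (shift a b c)) (residue-≡⇒∣ a b ra≡rb))
    where
    shift : ∀ a b c → a + c - (b + c) ≡ a - b
    shift = solve-∀

  residue-toℕ : ∀ i → residue (+ toℕ i) ≡ i
  residue-toℕ i = toℕ-injective (trans (toℕ-residue (+ toℕ i)) (m<n⇒m%n≡m (toℕ<n i)))

  toℕ-residue-+ : ∀ z j → toℕ (residue (z + + j)) ≡ (toℕ (residue z) ℕ.+ j) % n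
  toℕ-residue-+ z j =
    trans (cong toℕ (∣⇒residue-≡ (z + + j) (+ (r ℕ.+ j)) n∣)) (toℕ-residue (+ (r ℕ.+ j)))
    where
    r = toℕ (residue z)
    shift : ∀ z r j → z - r ≡ z + j - (r + j)
    shift = solve-∀
    n∣ : + n ∣ z + + j - + (r ℕ.+ j)
    n∣ = subst (+ n ∣_) (trans (shift z (+ r) (+ j)) (cong (λ t → z + + j - t) (sym (ℤₚ.pos-+ r j))))
           (n∣z-residue z)

  DiffBy-residue⁺ : ∀ a j → DiffBy n j (residue a) (residue (a + + j))
  DiffBy-residue⁺ a j = inj₁ (sym (toℕ-residue-+ a j))

  DiffBy-residue⁻ : ∀ a j → DiffBy n j (residue a) (residue (a - + j))
  DiffBy-residue⁻ a j =
    inj₂ (trans (sym (toℕ-residue-+ (a - + j) j)) (cong (toℕ ∘ residue) (cancel a (+ j))))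
    where
    cancel : ∀ a j → a - j + j ≡ a
    cancel = solve-∀

  DiffBy-residue⇒± : ∀ a j w → DiffBy n j (residue a) w →
                     w ≡ residue (a + + j) ⊎ w ≡ residue (a - + j)
  DiffBy-residue⇒± a j w (inj₁ [a+j]%n≡w) =
    inj₁ (toℕ-injective (trans (sym [a+j]%n≡w) (sym (toℕ-residue-+ a j))))
  DiffBy-residue⇒± a j w (inj₂ [w+j]%n≡a) =
    inj₂ (trans (sym (residue-toℕ w)) (∣⇒residue-≡ (+ toℕ w) (a - + j) n∣))
    where
    shift : ∀ w j a → w + j - a ≡ w - (a - j)
    shift = solve-∀
    w+j≡a : residue (+ toℕ w + + j) ≡ residue a
    w+j≡a = toℕ-injective (trans (toℕ-residue-+ (+ toℕ w) j)
              (trans (cong (λ r → (toℕ r ℕ.+ j) % n) (residue-toℕ w)) [w+j]%n≡a))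
    n∣ : + n ∣ + toℕ w - (a - + j)
    n∣ = subst (+ n ∣_) (shift (+ toℕ w) (+ j) a) (residue-≡⇒∣ (+ toℕ w + + j) a w+j≡a)

module GridSteps where

  open import Data.Integer using (_+_; _-_; -_)
  open import Data.Integer.Tactic.RingSolver using (solve-∀)
  open Algebra.Properties.AbelianGroup ℤₚ.+-0-abelianGroup using () renaming (∙-cancelʳ to +-cancelʳ)

  data Step : Set where
    here east west north south : Step

  _⊕_ : ℤ² → Step → ℤ²
  (x , y) ⊕ here  = x , y
  (x , y) ⊕ east  = x + + 1 , y
  (x , y) ⊕ west  = x - + 1 , y
  (x , y) ⊕ north = x , y + + 1
  (x , y) ⊕ south = x , y - + 1

  x-[x+a]≡-a : ∀ x a → x - (x + a) ≡ - a
  x-[x+a]≡-a = solve-∀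

  adjacent-⊕ : ∀ p s → GridN p (p ⊕ s)
  adjacent-⊕ (x , y) here  rewrite ℤₚ.+-inverseʳ x | ℤₚ.+-inverseʳ y        = z≤n
  adjacent-⊕ (x , y) east  rewrite x-[x+a]≡-a x (+ 1) | ℤₚ.+-inverseʳ y     = s≤s z≤n
  adjacent-⊕ (x , y) west  rewrite x-[x+a]≡-a x (- + 1) | ℤₚ.+-inverseʳ y   = s≤s z≤n
  adjacent-⊕ (x , y) north rewrite ℤₚ.+-inverseʳ x | x-[x+a]≡-a y (+ 1)     = s≤s z≤n
  adjacent-⊕ (x , y) south rewrite ℤₚ.+-inverseʳ x | x-[x+a]≡-a y (- + 1)   = s≤s z≤n

  adjacent⇒step : ∀ p r → GridN p r → ∃[ s ] r ≡ p ⊕ s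
  adjacent⇒step (x , y) (x' , y') = classify (x - x') (y - y') (recover x x') (recover y y')
    where
    recover : ∀ x x' → x' ≡ x + - (x - x')
    recover = solve-∀
    x+0 = ℤₚ.+-identityʳ x
    y+0 = ℤₚ.+-identityʳ y
    classify : ∀ u v → x' ≡ x + - u → y' ≡ y + - v → ℤ.∣ u ∣ ℕ.+ ℤ.∣ v ∣ ℕ.≤ 1 →
               ∃[ s ] (x' , y') ≡ (x , y) ⊕ s
    classify (+ 0)    (+ 0)    x'≡ y'≡ _ = here  , cong₂ _,_ (trans x'≡ x+0) (trans y'≡ y+0)
    classify (+ 0)    (+ 1)    x'≡ y'≡ _ = south , cong₂ _,_ (trans x'≡ x+0) y'≡
    classify (+ 0)    -[1+ 0 ] x'≡ y'≡ _ = north , cong₂ _,_ (trans x'≡ x+0) y'≡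
    classify (+ 1)    (+ 0)    x'≡ y'≡ _ = west  , cong₂ _,_ x'≡ (trans y'≡ y+0)
    classify -[1+ 0 ] (+ 0)    x'≡ y'≡ _ = east  , cong₂ _,_ x'≡ (trans y'≡ y+0)
    classify (+ 0)           (+ suc (suc _)) _ _ (s≤s ())
    classify (+ 0)           -[1+ suc _ ]    _ _ (s≤s ())
    classify (+ 1)           (+ suc _)       _ _ (s≤s ())
    classify (+ 1)           -[1+ _ ]        _ _ (s≤s ())
    classify (+ suc (suc _)) _               _ _ (s≤s ())
    classify -[1+ 0 ]        (+ suc _)       _ _ (s≤s ())
    classify -[1+ 0 ]        -[1+ _ ]        _ _ (s≤s ())
    classify -[1+ suc _ ]    _               _ _ (s≤s ())

  ⊕-cancelʳ : ∀ {p q} s → p ⊕ s ≡ q ⊕ s → p ≡ q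
  ⊕-cancelʳ {x , y} {x' , y'} here  eq = eq
  ⊕-cancelʳ {x , y} {x' , y'} east  eq = cong₂ _,_ (+-cancelʳ _ x x' (cong proj₁ eq)) (cong proj₂ eq)
  ⊕-cancelʳ {x , y} {x' , y'} west  eq = cong₂ _,_ (+-cancelʳ _ x x' (cong proj₁ eq)) (cong proj₂ eq)
  ⊕-cancelʳ {x , y} {x' , y'} north eq = cong₂ _,_ (cong proj₁ eq) (+-cancelʳ _ y y' (cong proj₂ eq))
  ⊕-cancelʳ {x , y} {x' , y'} south eq = cong₂ _,_ (cong proj₁ eq) (+-cancelʳ _ y y' (cong proj₂ eq))

  data EastWest : Step → Step → Set where
    east-west : EastWest east west
    west-east : EastWest west east

  GridN⇒∣Δx∣≤1 : ∀ p r → GridN p r → ℤ.∣ proj₁ p - proj₁ r ∣ ℕ.≤ 1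
  GridN⇒∣Δx∣≤1 _ _ = ℕₚ.≤-trans (ℕₚ.m≤m+n _ _)

  east-west-gap : ∀ x x' → x + + 1 ≡ x' - + 1 → x' - (x - + 1) ≡ + 3
  east-west-gap x x' e = begin
    x' - (x - + 1)                ≡⟨ regroup x x' ⟩
    x' - + 1 - (x + + 1) + + 3    ≡⟨ cong (λ t → t - (x + + 1) + + 3) e ⟨
    x + + 1 - (x + + 1) + + 3     ≡⟨ cong (_+ + 3) (ℤₚ.+-inverseʳ (x + + 1)) ⟩
    + 3                           ∎
    where
    open ≡-Reasoning
    regroup : ∀ x x' → x' - (x - + 1) ≡ x' - + 1 - (x + + 1) + + 3
    regroup = solve-∀

  west-east-gap : ∀ x x' → x - + 1 ≡ x' + + 1 → x' - (x + + 1) ≡ - + 3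
  west-east-gap x x' e = begin
    x' - (x + + 1)                ≡⟨ regroup x x' ⟩
    x' + + 1 - (x - + 1) - + 3    ≡⟨ cong (λ t → t - (x - + 1) - + 3) e ⟨
    x - + 1 - (x - + 1) - + 3     ≡⟨ cong (_- + 3) (ℤₚ.+-inverseʳ (x - + 1)) ⟩
    - + 3                         ∎
    where
    open ≡-Reasoning
    regroup : ∀ x x' → x' - (x + + 1) ≡ x' + + 1 - (x - + 1) - + 3
    regroup = solve-∀

  EastWest-far : ∀ {p q s₁ s₂} → EastWest s₁ s₂ → p ⊕ s₁ ≡ q ⊕ s₂ → ¬ GridN q (p ⊕ s₂)
  EastWest-far {p@(x , _)} {q@(x' , _)} east-west eq q~p⊕west =
    contradiction (GridN⇒∣Δx∣≤1 q (p ⊕ west) q~p⊕west)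
      (subst (λ t → ¬ ℤ.∣ t ∣ ℕ.≤ 1) (sym (east-west-gap x x' (cong proj₁ eq))) λ { (s≤s ()) })
  EastWest-far {p@(x , _)} {q@(x' , _)} west-east eq q~p⊕east =
    contradiction (GridN⇒∣Δx∣≤1 q (p ⊕ east) q~p⊕east)
      (subst (λ t → ¬ ℤ.∣ t ∣ ℕ.≤ 1) (sym (west-east-gap x x' (cong proj₁ eq))) λ { (s≤s ()) })

record Cover {V W : Set} (NV : V → V → Set) (NW : W → W → Set) : Set where
  field
    π          : W → V
    surjective : ∀ v → ∃[ p ] π p ≡ v
    adjacent   : ∀ p r → NW p r → NV (π p) (π r)
    lift       : ∀ p v → NV (π p) v → ∃[ r ] (NW p r × π r ≡ v)
    separate   : ∀ p q r → π p ≡ π q → p ≢ q → NW p r → NW q r →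
                 ∃[ r' ] (NW p r' × π r' ≡ π r × ¬ NW q r')

module _ {V : Set} (NB : V → V → Set) (C : V → Set) where

  Separated : V → V → Set
  Separated u v = ∃[ w ] (InI NB C u w × ¬ InI NB C v w)

  Separated⇒¬SameI : ∀ {u v} → Separated u v → ¬ SameI NB C u v
  Separated⇒¬SameI (w , u∋w , v∌w) same = v∌w (Equivalence.to (same w) u∋w)

  SelfIdentifying⇒Dominating : (∀ u → ∃[ v ] v ≢ u) → SelfIdentifying NB C → Dominating NB C
  SelfIdentifying⇒Dominating other (_ , separated) u with other u
  ... | v , v≢u with separated u v (v≢u ∘ sym)
  ...   | w , u∋w , _ = w , u∋w

module Pullback {V W : Set} {NV : V → V → Set} {NW : W → W → Set} (cover : Cover NV NW)
                (_≟_ : DecidableEquality V) (NW? : ∀ p r → Dec (NW p r))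
                {CV : V → Set} {CW : W → Set} (CW⇔CV∘π : ∀ w → CW w ⇔ CV (Cover.π cover w)) where

  open Cover cover

  code⇒ : ∀ w → CW w → CV (π w)
  code⇒ w = Equivalence.to (CW⇔CV∘π w)

  code⇐ : ∀ w → CV (π w) → CW w
  code⇐ w = Equivalence.from (CW⇔CV∘π w)

  push-I : ∀ p w → InI NW CW p w → InI NV CV (π p) (π w)
  push-I p w (p~w , w∈C) = adjacent p w p~w , code⇒ w w∈C

  lift-I : ∀ p v → InI NV CV (π p) v → ∃[ w ] (InI NW CW p w × π w ≡ v)
  lift-I p v (πp~v , v∈C) with lift p v πp~v
  ... | w , p~w , refl = w , (p~w , code⇐ w v∈C) , refl

  SameI-push : ∀ p q → SameI NW CW p q → SameI NV CV (π p) (π q)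
  SameI-push p q same v = mk⇔ (transport p q same) (transport q p (λ w → ⇔.sym (same w)))
    where
    transport : ∀ p q → SameI NW CW p q → InI NV CV (π p) v → InI NV CV (π q) v
    transport p q same p∋v with lift-I p v p∋v
    ... | w , p∋w , refl = push-I q w (Equivalence.to (same w) p∋w)

  Separated-lift : ∀ p q → Separated NV CV (π p) (π q) → Separated NW CW p q
  Separated-lift p q (v , πp∋v , πq∌v) with lift-I p v πp∋v
  ... | w , p∋w , refl = w , p∋w , πq∌v ∘ push-I q w

  Separated-fibre : Dominating NW CW → ∀ p q → π p ≡ π q → p ≢ q → Separated NW CW p q
  Separated-fibre dominating p q πp≡πq p≢q with dominating p
  ... | w , p∋w@(p~w , w∈C) with NW? q w
  ...   | no ¬q~w = w , p∋w , ¬q~w ∘ proj₁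
  ...   | yes q~w with separate p q w πp≡πq p≢q p~w q~w
  ...     | r , p~r , πr≡πw , ¬q~r =
    r , (p~r , code⇐ r (subst CV (sym πr≡πw) (code⇒ w w∈C))) , ¬q~r ∘ proj₁

  Nonempty-pull : Nonempty NV CV → Nonempty NW CW
  Nonempty-pull (v , v∈C) with surjective v
  ... | p , refl = p , code⇐ p v∈C

  Dominating-pull : Dominating NV CV → Dominating NW CW
  Dominating-pull dominating p with lift-I p _ (proj₂ (dominating (π p)))
  ... | w , p∋w , _ = w , p∋w

  ¬SameI-pull : Dominating NV CV → ∀ p q → p ≢ q →
                (π p ≢ π q → ¬ SameI NV CV (π p) (π q)) → ¬ SameI NW CW p q
  ¬SameI-pull dominating p q p≢q distinct with π p ≟ π q
  ... | yes πp≡πq =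
    Separated⇒¬SameI NW CW (Separated-fibre (Dominating-pull dominating) p q πp≡πq p≢q)
  ... | no πp≢πq  = distinct πp≢πq ∘ SameI-push p q

  Identifying-pull : Identifying NV CV → Identifying NW CW
  Identifying-pull (nonempty , dominating , distinct) =
    Nonempty-pull nonempty , Dominating-pull dominating ,
    λ p q p≢q → ¬SameI-pull dominating p q p≢q (distinct (π p) (π q))

  LocatingDominating-pull : LocatingDominating NV CV → LocatingDominating NW CW
  LocatingDominating-pull (nonempty , dominating , distinct) =
    Nonempty-pull nonempty , Dominating-pull dominating ,
    λ p q p≢q p∉C q∉C → ¬SameI-pull dominating p q p≢q
      (λ πp≢πq → distinct (π p) (π q) πp≢πq (p∉C ∘ code⇐ p) (q∉C ∘ code⇐ q))

  SelfIdentifying-pull : (∀ u → ∃[ v ] v ≢ u) → SelfIdentifying NV CV → SelfIdentifying NW CW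
  SelfIdentifying-pull other selfIdentifying@(nonempty , separated) =
    Nonempty-pull nonempty , separated′
    where
    dominating : Dominating NW CW
    dominating = Dominating-pull (SelfIdentifying⇒Dominating NV CV other selfIdentifying)
    separated′ : ∀ p q → p ≢ q → Separated NW CW p q
    separated′ p q p≢q with π p ≟ π q
    ... | yes πp≡πq = Separated-fibre dominating p q πp≡πq p≢q
    ... | no πp≢πq  = Separated-lift p q (separated (π p) (π q) πp≢πq)

module CirculantCover (n c : ℕ) .{{_ : NonZero n}} (d+1<n : 3 ℕ.+ c ℕ.< n) where

  open import Data.Integer using (_+_; _-_; _*_; -_)
  open import Data.Integer.Tactic.RingSolver using (solve-∀)
  open Residue n
  open GridSteps

  d : ℕ
  d = 2 ℕ.+ c

  ℓ : ℤ² → ℤ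
  ℓ (x , y) = + d * x + y

  π : ℤ² → Fin n
  π = residue ∘ ℓ

  δ : Step → ℤ
  δ here  = + 0
  δ east  = + d
  δ west  = - + d
  δ north = + 1
  δ south = - + 1

  ℓ-⊕ : ∀ p s → ℓ (p ⊕ s) ≡ ℓ p + δ s
  ℓ-⊕ (x , y) = along
    where
    east-linear : ∀ D x y → D * (x + + 1) + y ≡ D * x + y + D
    east-linear = solve-∀
    west-linear : ∀ D x y → D * (x - + 1) + y ≡ D * x + y - D
    west-linear = solve-∀
    along : ∀ s → ℓ ((x , y) ⊕ s) ≡ ℓ (x , y) + δ s
    along here  = sym (ℤₚ.+-identityʳ (ℓ (x , y)))
    along east  = east-linear (+ d) x y
    along west  = west-linear (+ d) x y
    along north = sym (ℤₚ.+-assoc (+ d * x) y (+ 1))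
    along south = sym (ℤₚ.+-assoc (+ d * x) y (- + 1))

  π-⊕ : ∀ p s → π (p ⊕ s) ≡ residue (ℓ p + δ s)
  π-⊕ p s = cong residue (ℓ-⊕ p s)

  π-⊕-cong : ∀ {p q} s → π p ≡ π q → π (p ⊕ s) ≡ π (q ⊕ s)
  π-⊕-cong {p} {q} s πp≡πq =
    trans (π-⊕ p s) (trans (residue-+-cong (ℓ p) (ℓ q) (δ s) πp≡πq) (sym (π-⊕ q s)))

  π-step : ∀ p s → CircN n d (π p) (π (p ⊕ s))
  π-step p s = subst (CircN n d (π p)) (sym (π-⊕ p s)) (by s)
    where
    by : ∀ s → CircN n d (π p) (residue (ℓ p + δ s))
    by here  = inj₁ (DiffBy-residue⁺ (ℓ p) 0)
    by north = inj₂ (inj₁ (DiffBy-residue⁺ (ℓ p) 1))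
    by south = inj₂ (inj₁ (DiffBy-residue⁻ (ℓ p) 1))
    by east  = inj₂ (inj₂ (DiffBy-residue⁺ (ℓ p) d))
    by west  = inj₂ (inj₂ (DiffBy-residue⁻ (ℓ p) d))

  π-adjacent : ∀ p r → GridN p r → CircN n d (π p) (π r)
  π-adjacent p r p~r with adjacent⇒step p r p~r
  ... | s , refl = π-step p s

  π-lift : ∀ p w → CircN n d (π p) w → ∃[ r ] (GridN p r × π r ≡ w)
  π-lift p w = lift ∘ step
    where
    lift : (∃[ s ] w ≡ residue (ℓ p + δ s)) → ∃[ r ] (GridN p r × π r ≡ w)
    lift (s , w≡) = p ⊕ s , adjacent-⊕ p s , trans (π-⊕ p s) (sym w≡)
    step : CircN n d (π p) w → ∃[ s ] w ≡ residue (ℓ p + δ s)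
    step (inj₁ diff)        = [ here ,_  , here ,_  ] (DiffBy-residue⇒± (ℓ p) 0 w diff)
    step (inj₂ (inj₁ diff)) = [ north ,_ , south ,_ ] (DiffBy-residue⇒± (ℓ p) 1 w diff)
    step (inj₂ (inj₂ diff)) = [ east ,_  , west ,_  ] (DiffBy-residue⇒± (ℓ p) d w diff)

  private
    d<n : d ℕ.< n
    d<n = ℕₚ.<-trans (ℕₚ.n<1+n d) d+1<n
    d-1<n : suc c ℕ.< n
    d-1<n = ℕₚ.<-trans (ℕₚ.n<1+n (suc c)) d<n
    2<n : 2 ℕ.< n
    2<n = ℕₚ.≤-<-trans (s≤s (s≤s z≤n)) d<n
    1<n : 1 ℕ.< n
    1<n = ℕₚ.<-trans (ℕₚ.n<1+n 1) 2<n

  -- The three clauses through ∣-swap avoid differences such as + d - + 0, whose absolute value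
  -- is not of the form suc _ definitionally.
  step-collision : ∀ s₁ s₂ → + n ∣ δ s₁ - δ s₂ → s₁ ≡ s₂ ⊎ EastWest s₁ s₂
  step-collision here  here  _  = inj₁ refl
  step-collision east  east  _  = inj₁ refl
  step-collision west  west  _  = inj₁ refl
  step-collision north north _  = inj₁ refl
  step-collision south south _  = inj₁ refl
  step-collision east  west  _  = inj₂ east-west
  step-collision west  east  _  = inj₂ west-east
  step-collision here  east  n∣ = contradiction n∣ (∤-short z<s d<n)
  step-collision here  west  n∣ = contradiction n∣ (∤-short z<s d<n)
  step-collision here  north n∣ = contradiction n∣ (∤-short z<s 1<n)
  step-collision here  south n∣ = contradiction n∣ (∤-short z<s 1<n)
  step-collision east  here  n∣ = contradiction (∣-swap (δ east) (δ here) n∣) (∤-short z<s d<n)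
  step-collision east  north n∣ = contradiction n∣ (∤-short z<s d-1<n)
  step-collision east  south n∣ = contradiction (∣-swap (δ east) (δ south) n∣) (∤-short z<s d+1<n)
  step-collision west  here  n∣ = contradiction n∣ (∤-short z<s d<n)
  step-collision west  north n∣ = contradiction (∣-swap (δ west) (δ north) n∣) (∤-short z<s d+1<n)
  step-collision west  south n∣ = contradiction n∣ (∤-short z<s d-1<n)
  step-collision north here  n∣ = contradiction n∣ (∤-short z<s 1<n)
  step-collision north east  n∣ = contradiction n∣ (∤-short z<s d-1<n)
  step-collision north west  n∣ = contradiction n∣ (∤-short z<s d+1<n)
  step-collision north south n∣ = contradiction n∣ (∤-short z<s 2<n)
  step-collision south here  n∣ = contradiction n∣ (∤-short z<s 1<n)
  step-collision south east  n∣ = contradiction n∣ (∤-short z<s d+1<n)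
  step-collision south west  n∣ = contradiction n∣ (∤-short z<s d-1<n)
  step-collision south north n∣ = contradiction n∣ (∤-short z<s 2<n)

  fibre-steps-∣ : ∀ p q s₁ s₂ → π p ≡ π q → p ⊕ s₁ ≡ q ⊕ s₂ → + n ∣ δ s₁ - δ s₂
  fibre-steps-∣ p q s₁ s₂ πp≡πq p⊕s₁≡q⊕s₂ =
    subst (+ n ∣_) (sym (difference (ℓ p) (ℓ q) (δ s₁) (δ s₂) ℓp+δ₁≡ℓq+δ₂))
      (residue-≡⇒∣ (ℓ q) (ℓ p) (sym πp≡πq))
    where
    ℓp+δ₁≡ℓq+δ₂ : ℓ p + δ s₁ ≡ ℓ q + δ s₂
    ℓp+δ₁≡ℓq+δ₂ = trans (sym (ℓ-⊕ p s₁)) (trans (cong ℓ p⊕s₁≡q⊕s₂) (ℓ-⊕ q s₂))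
    difference : ∀ a b u v → a + u ≡ b + v → u - v ≡ b - a
    difference a b u v e = begin
      u - v           ≡⟨ regroup a u v ⟩
      a + u - a - v   ≡⟨ cong (λ t → t - a - v) e ⟩
      b + v - a - v   ≡⟨ regroup′ a b v ⟩
      b - a           ∎
      where
      open ≡-Reasoning
      regroup : ∀ a u v → u - v ≡ a + u - a - v
      regroup = solve-∀
      regroup′ : ∀ a b v → b + v - a - v ≡ b - a
      regroup′ = solve-∀

  π-separates : ∀ p q r → π p ≡ π q → p ≢ q → GridN p r → GridN q r →
                ∃[ r' ] (GridN p r' × π r' ≡ π r × ¬ GridN q r')
  π-separates p q r πp≡πq p≢q p~r q~r with adjacent⇒step p r p~r | adjacent⇒step q r q~r
  ... | s₁ , refl | s₂ , p⊕s₁≡q⊕s₂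
    with step-collision s₁ s₂ (fibre-steps-∣ p q s₁ s₂ πp≡πq p⊕s₁≡q⊕s₂)
  ...   | inj₁ refl = contradiction (⊕-cancelʳ s₁ p⊕s₁≡q⊕s₂) p≢q
  ...   | inj₂ east-west-pair =
    p ⊕ s₂ , adjacent-⊕ p s₂ , trans (π-⊕-cong s₂ πp≡πq) (cong π (sym p⊕s₁≡q⊕s₂)) ,
    EastWest-far east-west-pair p⊕s₁≡q⊕s₂

  π-surjective : ∀ v → ∃[ p ] π p ≡ v
  π-surjective v = (+ 0 , + toℕ v) , trans (cong residue ℓ[0,v]≡v) (residue-toℕ v)
    where
    ℓ[0,v]≡v : ℓ (+ 0 , + toℕ v) ≡ + toℕ v
    ℓ[0,v]≡v = trans (cong (_+ + toℕ v) (ℤₚ.*-zeroʳ (+ d))) (ℤₚ.+-identityˡ (+ toℕ v))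

  cover : Cover (CircN n d) GridN
  cover = record
    { π          = π
    ; surjective = π-surjective
    ; adjacent   = π-adjacent
    ; lift       = π-lift
    ; separate   = π-separates
    }

module Counting where

  open import Data.Nat using (_+_; _*_; _∸_; _≤_; _<_)
  open import Data.Nat.Tactic.RingSolver using (solve-∀)

  indicator : Bool → ℕ
  indicator true  = 1
  indicator false = 0

  infixl 20 _»_

  _»_ : (ℕ → Bool) → ℕ → (ℕ → Bool)
  (h » s) i = h (s + i)

  count : (ℕ → Bool) → ℕ → ℕ
  count h zero    = 0
  count h (suc L) = indicator (h 0) + count (h » 1) L

  count-cong : ∀ {h h'} L → (∀ i → h i ≡ h' i) → count h L ≡ count h' L
  count-cong zero    h≗h' = refl
  count-cong (suc L) h≗h' = cong₂ _+_ (cong indicator (h≗h' 0)) (count-cong L (h≗h' ∘ suc))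

  count-+ : ∀ h a b → count h (a + b) ≡ count h a + count (h » a) b
  count-+ h zero    b = refl
  count-+ h (suc a) b = trans (cong (λ m → indicator (h 0) + m) (count-+ (h » 1) a b))
                              (sym (ℕₚ.+-assoc (indicator (h 0)) _ _))

  count-mono : ∀ h {t L} → t ≤ L → count h t ≤ count h L
  count-mono h {t} {L} t≤L = begin
    count h t                           ≤⟨ ℕₚ.m≤m+n _ _ ⟩
    count h t + count (h » t) (L ∸ t)   ≡⟨ count-+ h t (L ∸ t) ⟨
    count h (t + (L ∸ t))               ≡⟨ cong (count h) (ℕₚ.m+[n∸m]≡n t≤L) ⟩
    count h L                           ∎
    where open ℕₚ.≤-Reasoning

  count-lookup : ∀ {m} (v : Vec Bool m) h → (∀ i (i<m : i < m) → h i ≡ lookup v (fromℕ< i<m)) →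
                 count h m ≡ ∣ v ∣
  count-lookup []      h h≡v = refl
  count-lookup (b ∷ v) h h≡v with h 0 | h≡v 0 z<s
  ... | true  | refl = cong suc (count-lookup v (h » 1) λ i i<m → h≡v (suc i) (s≤s i<m))
  ... | false | refl = count-lookup v (h » 1) λ i i<m → h≡v (suc i) (s≤s i<m)

  Periodic : ℕ → (ℕ → Bool) → Set
  Periodic n h = ∀ i → h (n + i) ≡ h i

  Periodic-shift : ∀ {n h} s → Periodic n h → Periodic n (h » s)
  Periodic-shift {n} {h} s periodic i = trans (cong h (swap s n i)) (periodic (s + i))
    where
    swap : ∀ s n i → s + (n + i) ≡ n + (s + i)
    swap = solve-∀

  count-rotate : ∀ {n h} → Periodic n h → count (h » 1) n ≡ count h n
  count-rotate {n} {h} periodic = ℕₚ.+-cancelˡ-≡ (indicator (h 0)) _ _ (begin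
    count h (suc n)                           ≡⟨ cong (count h) (ℕₚ.+-comm 1 n) ⟩
    count h (n + 1)                           ≡⟨ count-+ h n 1 ⟩
    count h n + (indicator (h (n + 0)) + 0)   ≡⟨ cong (λ b → count h n + (indicator b + 0)) (periodic 0) ⟩
    count h n + (indicator (h 0) + 0)         ≡⟨ cong (λ m → count h n + m) (ℕₚ.+-identityʳ _) ⟩
    count h n + indicator (h 0)               ≡⟨ ℕₚ.+-comm (count h n) _ ⟩
    indicator (h 0) + count h n               ∎)
    where open ≡-Reasoning

  count-period : ∀ {n h} → Periodic n h → ∀ s → count (h » s) n ≡ count h n
  count-period periodic zero = refl
  count-period {n} {h} periodic (suc s) = begin
    count (h » suc s) n   ≡⟨ count-cong n (λ i → cong h (ℕₚ.+-suc s i)) ⟨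
    count (h » s » 1) n   ≡⟨ count-rotate (Periodic-shift s periodic) ⟩
    count (h » s) n       ≡⟨ count-period periodic s ⟩
    count h n             ∎
    where open ≡-Reasoning

  Close : ℕ → ℕ → ℕ → Set
  Close e x y = x ≤ y + e × y ≤ x + e

  Close-≡ : ∀ {x y} → x ≡ y → Close 0 x y
  Close-≡ {x} refl = ℕₚ.m≤m+n x 0 , ℕₚ.m≤m+n x 0

  Close-+ : ∀ {e e' x x' y y'} → Close e x y → Close e' x' y' → Close (e + e') (x + x') (y + y')
  Close-+ {e} {e'} {x} {x'} {y} {y'} (x≤ , y≤) (x'≤ , y'≤) =
    ℕₚ.≤-trans (ℕₚ.+-mono-≤ x≤ x'≤) (ℕₚ.≤-reflexive (interchange y e y' e')) ,
    ℕₚ.≤-trans (ℕₚ.+-mono-≤ y≤ y'≤) (ℕₚ.≤-reflexive (interchange x e x' e'))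
    where
    interchange : ∀ a b c d → (a + b) + (c + d) ≡ (a + c) + (b + d)
    interchange = solve-∀

  Close-sum : ∀ {A : Set} n e a (R : A → ℕ) → (∀ x → Close e (n * R x) a) →
              ∀ xs → Close (length xs * e) (n * sum (map R xs)) (length xs * a)
  Close-sum n e a R close []       = Close-≡ (ℕₚ.*-zeroʳ n)
  Close-sum n e a R close (x ∷ xs) =
    subst (λ t → Close (length (x ∷ xs) * e) t (length (x ∷ xs) * a))
      (sym (ℕₚ.*-distribˡ-+ n (R x) _)) (Close-+ (close x) (Close-sum n e a R close xs))

  count-close : ∀ {n k h} .{{_ : NonZero n}} → Periodic n h → count h n ≡ k →
                ∀ L → Close (k * n) (n * count h L) (k * L)
  count-close {n} {k} {h} periodic period≡k L =
    subst (λ L → Close (k * n) (n * count h L) (k * L)) (sym L≡)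
      (blocks (L ℕ./ n) (L % n) (ℕₚ.<⇒≤ (m%n<n L n)) periodic period≡k)
    where
    L≡ : L ≡ L ℕ./ n * n + L % n
    L≡ = trans (m≡m%n+[m/n]*n L n) (ℕₚ.+-comm (L % n) _)
    blocks : ∀ q t → t ≤ n → ∀ {h} → Periodic n h → count h n ≡ k →
             Close (k * n) (n * count h (q * n + t)) (k * (q * n + t))
    blocks zero t t≤n {h} periodic period≡k =
      ℕₚ.≤-trans (ℕₚ.*-monoʳ-≤ n W≤k)
        (ℕₚ.≤-trans (ℕₚ.≤-reflexive (ℕₚ.*-comm n k)) (ℕₚ.m≤n+m (k * n) (k * t))) ,
      ℕₚ.≤-trans (ℕₚ.*-monoʳ-≤ k t≤n) (ℕₚ.m≤n+m (k * n) (n * count h t))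
      where
      W≤k : count h t ≤ k
      W≤k = subst (count h t ≤_) period≡k (count-mono h t≤n)
    blocks (suc q) t t≤n {h} periodic period≡k =
      subst₂ (Close (k * n)) (sym n*W≡) (sym k*L≡)
        (Close-+ (Close-≡ (ℕₚ.*-comm n k)) (blocks q t t≤n periodic period≡k))
      where
      L' = q * n + t
      W≡ : count h (n + L') ≡ k + count h L'
      W≡ = trans (count-+ h n L') (cong₂ _+_ period≡k (count-cong L' periodic))
      n*W≡ : n * count h (suc q * n + t) ≡ n * k + n * count h L'
      n*W≡ = trans (cong (λ L → n * count h L) (ℕₚ.+-assoc n (q * n) t))
               (trans (cong (n *_) W≡) (ℕₚ.*-distribˡ-+ n k _))
      k*L≡ : k * (suc q * n + t) ≡ k * n + k * L'
      k*L≡ = trans (cong (k *_) (ℕₚ.+-assoc n (q * n) t)) (ℕₚ.*-distribˡ-+ k n L')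

side : ℕ → ℕ
side m = suc (2 ℕ.* m)

module GridCounting where

  open import Data.Integer using (_-_)
  open import Data.Bool using () renaming (_≟_ to _≟ᵇ_)
  open Counting

  length-filter-concatMap : ∀ {A B : Set} {P : Pred B 0ℓ} (P? : Decidable P) (g : A → List B) xs →
                            length (filter P? (concatMap g xs)) ≡ sum (map (length ∘ filter P? ∘ g) xs)
  length-filter-concatMap P? g []       = refl
  length-filter-concatMap P? g (x ∷ xs) = begin
    length (filter P? (g x ++ concatMap g xs))
      ≡⟨ cong length (Listₚ.filter-++ P? (g x) _) ⟩
    length (filter P? (g x) ++ filter P? (concatMap g xs))
      ≡⟨ Listₚ.length-++ (filter P? (g x)) ⟩
    length (filter P? (g x)) ℕ.+ length (filter P? (concatMap g xs))
      ≡⟨ cong (length (filter P? (g x)) ℕ.+_) (length-filter-concatMap P? g xs) ⟩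
    length (filter P? (g x)) ℕ.+ sum (map (length ∘ filter P? ∘ g) xs)
      ∎
    where open ≡-Reasoning

  length-filter-applyUpTo : ∀ {A : Set} (f : A → Bool) (g : ℕ → A) L →
                            length (filter (λ a → f a ≟ᵇ true) (applyUpTo g L)) ≡ count (f ∘ g) L
  length-filter-applyUpTo f g zero = refl
  length-filter-applyUpTo f g (suc L) with f (g 0)
  ... | true  = cong suc (length-filter-applyUpTo f (g ∘ suc) L)
  ... | false = length-filter-applyUpTo f (g ∘ suc) L

  countQ-rows : ∀ f m →
                countQ f m ≡ sum (map (λ x → count (λ i → f (x , + i - + m)) (side m)) (range m))
  countQ-rows f m =
    trans (length-filter-concatMap f∋? row (range m)) (cong sum (Listₚ.map-cong row-count (range m)))
    where
    f∋? : ∀ p → Dec (f p ≡ true)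
    f∋? p = f p ≟ᵇ true
    column : ℕ → ℤ
    column i = + i - + m
    row : ℤ → List ℤ²
    row x = map (x ,_) (range m)
    row-count : ∀ x → length (filter f∋? (row x)) ≡ count (λ i → f (x , column i)) (side m)
    row-count x = begin
      length (filter f∋? (map (x ,_) (map column (upTo (side m)))))
        ≡⟨ cong (λ l → length (filter f∋? (map (x ,_) l))) (Listₚ.map-applyUpTo id column (side m)) ⟩
      length (filter f∋? (map (x ,_) (applyUpTo column (side m))))
        ≡⟨ cong (length ∘ filter f∋?) (Listₚ.map-applyUpTo column (x ,_) (side m)) ⟩
      length (filter f∋? (applyUpTo (λ i → x , column i) (side m)))
        ≡⟨ length-filter-applyUpTo f (λ i → x , column i) (side m) ⟩
      count (λ i → f (x , column i)) (side m)
        ∎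
      where open ≡-Reasoning

module ColumnPeriodicCode (n : ℕ) .{{_ : NonZero n}} (C : Subset n) (A : ℤ → ℤ) where

  open import Data.Integer using (_+_; _-_)
  open import Data.Integer.Tactic.RingSolver using (solve-∀)
  open Residue n
  open Counting
  open GridCounting

  code : GridCode
  code (x , y) = lookup C (residue (A x + y))

  column : ℕ → Bool
  column i = lookup C (residue (+ i))

  column-periodic : Periodic n column
  column-periodic i = cong (lookup C) (toℕ-injective (begin
    toℕ (residue (+ (n ℕ.+ i)))   ≡⟨ toℕ-residue (+ (n ℕ.+ i)) ⟩
    (n ℕ.+ i) % n                 ≡⟨ cong (_% n) (ℕₚ.+-comm n i) ⟩
    (i ℕ.+ n) % n                 ≡⟨ [m+n]%n≡m%n i n ⟩
    i % n                         ≡⟨ toℕ-residue (+ i) ⟨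
    toℕ (residue (+ i))           ∎))
    where open ≡-Reasoning

  column-count : count column n ≡ ∣ C ∣
  column-count = count-lookup C column λ i i<n → cong (lookup C) (toℕ-injective
    (trans (toℕ-residue (+ i)) (trans (m<n⇒m%n≡m i<n) (sym (toℕ-fromℕ< i<n)))))

  row-shift : ∀ m x i → code (x , + i - + m) ≡ (column » toℕ (residue (A x - + m))) i
  row-shift m x i = cong (lookup C) (toℕ-injective (begin
    toℕ (residue (A x + (+ i - + m)))       ≡⟨ cong (toℕ ∘ residue) (regroup (A x) (+ i) (+ m)) ⟩
    toℕ (residue (A x - + m + + i))         ≡⟨ toℕ-residue-+ (A x - + m) i ⟩
    (s ℕ.+ i) % n                           ≡⟨ toℕ-residue (+ (s ℕ.+ i)) ⟨
    toℕ (residue (+ (s ℕ.+ i)))             ∎))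
    where
    open ≡-Reasoning
    s = toℕ (residue (A x - + m))
    regroup : ∀ a i m → a + (i - m) ≡ a - m + i
    regroup = solve-∀

  code-close : ∀ m → Close (side m ℕ.* (∣ C ∣ ℕ.* n)) (n ℕ.* countQ code m)
                           (side m ℕ.* (∣ C ∣ ℕ.* side m))
  code-close m =
    subst (λ T → Close (L ℕ.* (k ℕ.* n)) (n ℕ.* T) (L ℕ.* (k ℕ.* L))) (sym (countQ-rows code m))
      (subst (λ l → Close (l ℕ.* (k ℕ.* n)) (n ℕ.* sum (map row (range m))) (l ℕ.* (k ℕ.* L)))
        length-range (Close-sum n (k ℕ.* n) (k ℕ.* L) row row-close (range m)))
    where
    k = ∣ C ∣
    L = side m
    row : ℤ → ℕ
    row x = count (λ i → code (x , + i - + m)) L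
    length-range : length (range m) ≡ L
    length-range = trans (Listₚ.length-map _ (upTo L)) (Listₚ.length-applyUpTo id L)
    row-close : ∀ x → Close (k ℕ.* n) (n ℕ.* row x) (k ℕ.* L)
    row-close x =
      subst (λ W → Close (k ℕ.* n) (n ℕ.* W) (k ℕ.* L)) (sym (count-cong L (row-shift m x)))
        (count-close (Periodic-shift s column-periodic)
          (trans (count-period column-periodic s) column-count) L)
      where
      s = toℕ (residue (A x - + m))

module DensityFromCounts where

  open import Data.Nat using (_+_; _*_; _≤_)
  open import Data.Nat.Coprimality using (Coprime)
  open import Data.Nat.Tactic.RingSolver using (solve-∀)
  open import Data.Rational as ℚ using (mkℚ; toℚᵘ)
  import Data.Rational.Properties as ℚₚ
  open import Data.Rational.Unnormalised as ℚᵘ using (mkℚᵘ; *<*)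
  import Data.Rational.Unnormalised.Properties as ℚᵘₚ
  open Counting using (Close)

  /<+ : ∀ u₁ v₁ u₂ v₂ a b .{{_ : NonZero v₁}} .{{_ : NonZero v₂}} .{c : Coprime a (suc b)} →
        u₁ * (v₂ * suc b) ℕ.< (u₂ * suc b + a * v₂) * v₁ →
        (+ u₁) / v₁ ℚ.< (+ u₂) / v₂ ℚ.+ mkℚ (+ a) b c
  /<+ u₁ (suc v₁) u₂ (suc v₂) a b {c} cross =
    ℚₚ.toℚᵘ-cancel-< (ℚᵘₚ.<-respˡ-≃ (ℚᵘₚ.≃-sym left) (ℚᵘₚ.<-respʳ-≃ (ℚᵘₚ.≃-sym right) unnormalised))
    where
    X = mkℚᵘ (+ u₁) v₁
    Y = mkℚᵘ (+ u₂) v₂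
    E = mkℚᵘ (+ a) b
    left : toℚᵘ ((+ u₁) / suc v₁) ℚᵘ.≃ X
    left = ℚₚ.toℚᵘ-fromℚᵘ X
    right : toℚᵘ ((+ u₂) / suc v₂ ℚ.+ mkℚ (+ a) b c) ℚᵘ.≃ Y ℚᵘ.+ E
    right = ℚᵘₚ.≃-trans (ℚₚ.toℚᵘ-homo-+ ((+ u₂) / suc v₂) (mkℚ (+ a) b c))
              (ℚᵘₚ.+-congˡ E (ℚₚ.toℚᵘ-fromℚᵘ Y))
    pos-rhs : + ((u₂ * suc b + a * suc v₂) * suc v₁) ≡
              (+ u₂ ℤ.* + suc b ℤ.+ + a ℤ.* + suc v₂) ℤ.* + suc v₁
    pos-rhs = trans (ℤₚ.pos-* (u₂ * suc b + a * suc v₂) (suc v₁))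
      (cong (ℤ._* + suc v₁) (trans (ℤₚ.pos-+ (u₂ * suc b) (a * suc v₂))
        (cong₂ ℤ._+_ (ℤₚ.pos-* u₂ (suc b)) (ℤₚ.pos-* a (suc v₂)))))
    unnormalised : X ℚᵘ.< Y ℚᵘ.+ E
    unnormalised = *<* (subst₂ ℤ._<_ (ℤₚ.pos-* u₁ _) pos-rhs (ℤ.+<+ cross))

  p<q+r⇒p-r<q : ∀ {p q r} → p ℚ.< q ℚ.+ r → p ℚ.- r ℚ.< q
  p<q+r⇒p-r<q {p} {q} {r} p<q+r = subst (p ℚ.- r ℚ.<_) q+r-r≡q (ℚₚ.+-monoˡ-< (ℚ.- r) p<q+r)
    where
    q+r-r≡q : q ℚ.+ r ℚ.- r ≡ q
    q+r-r≡q = trans (ℚₚ.+-assoc q r (ℚ.- r))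
                (trans (cong (q ℚ.+_) (ℚₚ.+-inverseʳ r)) (ℚₚ.+-identityʳ q))

  -- With L = side m, the bound reads |T / L² - k / n| ≤ k / L, which is below
  -- ε = (a + 1) / (b + 1) as soon as m ≥ k (b + 1).
  DensityEq-from-Close : ∀ f n k .{{_ : NonZero n}} →
    (∀ m → Close (side m * (k * n)) (n * countQ f m) (side m * (k * side m))) →
    DensityEq f ((+ k) / n)
  DensityEq-from-Close f n k close (mkℚ (+ zero) _ _) ()
  DensityEq-from-Close f n k close (mkℚ -[1+ _ ] _ _) ()
  DensityEq-from-Close f n k close ε@(mkℚ (+ suc a) b _) _ = (k * suc b , upper) , lower
    where
    B = suc b

    kB<aL : ∀ m → k * B ≤ m → k * B ℕ.< suc a * side m
    kB<aL m kB≤m =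
      ℕₚ.≤-trans (s≤s (ℕₚ.≤-trans kB≤m (ℕₚ.m≤m+n m (m + 0)))) (ℕₚ.m≤m+n (side m) (a * side m))

    gap : ∀ m c → k * B ≤ m → c + k * B * (n * side m) ℕ.< c + suc a * side m * (n * side m)
    gap m c kB≤m = ℕₚ.+-monoʳ-< c (ℕₚ.*-monoˡ-< (n * side m) {{ℕₚ.m*n≢0 n (side m)}} (kB<aL m kB≤m))

    above : ∀ m → k * B ≤ m →
            countQ f m * (n * B) ℕ.< (k * B + suc a * n) * (side m * side m)
    above m kB≤m = begin-strict
      T * (n * B)                             ≡⟨ regroup T n B ⟩
      (n * T) * B                             ≤⟨ ℕₚ.*-monoˡ-≤ B (proj₁ (close m)) ⟩
      (L * (k * L) + L * (k * n)) * B         ≡⟨ expand k B L n ⟩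
      k * B * (L * L) + k * B * (n * L)       <⟨ gap m (k * B * (L * L)) kB≤m ⟩
      k * B * (L * L) + suc a * L * (n * L)   ≡⟨ collect k B L n (suc a) ⟩
      (k * B + suc a * n) * (L * L)           ∎
      where
      open ℕₚ.≤-Reasoning
      T = countQ f m
      L = side m
      regroup : ∀ T n B → T * (n * B) ≡ (n * T) * B
      regroup = solve-∀
      expand : ∀ k B L n → (L * (k * L) + L * (k * n)) * B ≡ k * B * (L * L) + k * B * (n * L)
      expand = solve-∀
      collect : ∀ k B L n a → k * B * (L * L) + a * L * (n * L) ≡ (k * B + a * n) * (L * L)
      collect = solve-∀

    below : ∀ m → k * B ≤ m →
            k * (side m * side m * B) ℕ.< (countQ f m * B + suc a * (side m * side m)) * n
    below m kB≤m = begin-strict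
      k * (L * L * B)                         ≡⟨ regroup k L B ⟩
      (L * (k * L)) * B                       ≤⟨ ℕₚ.*-monoˡ-≤ B (proj₂ (close m)) ⟩
      (n * T + L * (k * n)) * B               ≡⟨ expand T n B L k ⟩
      T * B * n + k * B * (n * L)             <⟨ gap m (T * B * n) kB≤m ⟩
      T * B * n + suc a * L * (n * L)         ≡⟨ collect T n B L (suc a) ⟩
      (T * B + suc a * (L * L)) * n           ∎
      where
      open ℕₚ.≤-Reasoning
      T = countQ f m
      L = side m
      regroup : ∀ k L B → k * (L * L * B) ≡ (L * (k * L)) * B
      regroup = solve-∀
      expand : ∀ T n B L k → (n * T + L * (k * n)) * B ≡ T * B * n + k * B * (n * L)
      expand = solve-∀
      collect : ∀ T n B L a → T * B * n + a * L * (n * L) ≡ (T * B + a * (L * L)) * n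
      collect = solve-∀

    upper : ∀ m → k * B ≤ m → ratio f m ℚ.< (+ k) / n ℚ.+ ε
    upper m kB≤m = /<+ (countQ f m) _ k n (suc a) b (above m kB≤m)

    lower : ∀ M → ∃[ m ] (M ≤ m × (+ k) / n ℚ.- ε ℚ.< ratio f m)
    lower M = m , ℕₚ.m≤m+n M (k * B) ,
      p<q+r⇒p-r<q (/<+ k n (countQ f m) _ (suc a) b (below m (ℕₚ.m≤n+m (k * B) M)))
      where
      m = M + k * B

2+d≤2*d : ∀ {d} → 2 ℕ.≤ d → 2 ℕ.+ d ℕ.≤ 2 ℕ.* d
2+d≤2*d {d} 2≤d =
  subst₂ ℕ._≤_ (ℕₚ.+-comm d 2) (cong (d ℕ.+_) (sym (ℕₚ.+-identityʳ d))) (ℕₚ.+-monoʳ-≤ d 2≤d)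

Fin-other : ∀ {n} → 2 ℕ.≤ n → (v : Fin n) → ∃[ u ] u ≢ v
Fin-other (s≤s (s≤s _)) v = punchIn v Fin.zero , punchInᵢ≢i v Fin.zero

open DensityFromCounts using (DensityEq-from-Close)
open import Data.Nat using (_≤_; _*_)

theorem1 : (n d k : ℕ) .{{_ : NonZero n}} → 1 ≤ k → 2 ≤ d → 2 * d ≤ n →
  ((C : Subset n) → ∣ C ∣ ≡ k → Identifying (CircN n d) (_∈ C) →
     ∃[ f ] (Identifying GridN (InCode f) × DensityEq f ((+ k) / n)))
  × ((C : Subset n) → ∣ C ∣ ≡ k → LocatingDominating (CircN n d) (_∈ C) →
     ∃[ f ] (LocatingDominating GridN (InCode f) × DensityEq f ((+ k) / n)))
  × ((C : Subset n) → ∣ C ∣ ≡ k → SelfIdentifying (CircN n d) (_∈ C) →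
     ∃[ f ] (SelfIdentifying GridN (InCode f) × DensityEq f ((+ k) / n)))
theorem1 n d@(suc (suc c)) k _ 2≤d@(s≤s (s≤s _)) 2d≤n =
  (λ C ∣C∣≡k identifying → code C , Pull.Identifying-pull C identifying , density C ∣C∣≡k) ,
  (λ C ∣C∣≡k locating → code C , Pull.LocatingDominating-pull C locating , density C ∣C∣≡k) ,
  (λ C ∣C∣≡k selfIdentifying →
     code C , Pull.SelfIdentifying-pull C (Fin-other 2≤n) selfIdentifying , density C ∣C∣≡k)
  where
  2+d≤n : 2 ℕ.+ d ≤ n
  2+d≤n = ℕₚ.≤-trans (2+d≤2*d 2≤d) 2d≤n

  2≤n : 2 ≤ n
  2≤n = ℕₚ.≤-trans (ℕₚ.m≤m+n 2 d) 2+d≤n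

  open CirculantCover n c 2+d≤n using (π; cover)

  code : Subset n → GridCode
  code C = lookup C ∘ π

  module Pull (C : Subset n) =
    Pullback cover Fin._≟_ (λ p r → _ ℕ.≤? 1) {CV = _∈ C} {CW = InCode (code C)}
      (λ w → mk⇔ (lookup⇒[]= (π w) C) []=⇒lookup)

  density : ∀ C → ∣ C ∣ ≡ k → DensityEq (code C) ((+ k) / n)
  density C refl =
    DensityEq-from-Close (code C) n ∣ C ∣ (ColumnPeriodicCode.code-close n C (+ d ℤ.*_))
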